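{- Let $G$ be a connected graph of order $n\ge 2$ and let $H$ be a graph with $l\ge 1$ connected components $H_1,\dots,H_l$, where $|V(H_i)|=m_i\ge 2$ for each $i$. Then $$Z(G\circ H)\le n\Big(\sum_{i=1}^{l}m_i\Big)-l.$$
   Context: Graphs are finite, simple, undirected. Zero forcing: given a set $S$ of initially black vertices (others white), the color-change rule turns a white vertex black if it is the only white neighbor of some black vertex; $S$ is a zero forcing set if eventually all vertices become black; $Z(G)$ is the minimum size of a zero forcing set. The lexicographic product $G\circ H$ has vertex set $V(G)\times V(H)$, with $(a,v)$ adjacent to $(b,w)$ iff $ab\in E(G)$, or $a=b$ and $vw\in E(H)$. -}

module Defs where

open import Data.Nat using (ℕ; _≤_)
open import Data.Bool using (Bool; true; false; _∨_; _∧_)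
open import Data.Fin using (Fin; remQuot; _≟_)
open import Data.Fin.Subset using (Subset; _∈_; _∉_; _∪_; ⁅_⁆; ∣_∣)
open import Data.Product using (_×_; _,_; Σ; ∃)
open import Relation.Nullary using (¬_; does)
open import Relation.Binary.PropositionalEquality using (_≡_; _≢_)

Adjacency : ℕ → Set
Adjacency n = Fin n → Fin n → Bool

record IsSimple {n : ℕ} (adj : Adjacency n) : Set where
  field
    symmetric   : ∀ u v → adj u v ≡ adj v u
    irreflexive : ∀ v → adj v v ≡ false

data Reachable {n : ℕ} (adj : Adjacency n) : Fin n → Fin n → Set where
  here : ∀ {u} → Reachable adj u u
  edge : ∀ {u v w} → adj u v ≡ true → Reachable adj v w → Reachable adj u w

Connected : {n : ℕ} → Adjacency n → Set
Connected {n} adj = ∀ (u v : Fin n) → Reachable adj u v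

-- A labelling of the connected components of a graph on Fin m by Fin l:
-- every label is used, and two vertices get the same label iff they are
-- joined by a walk.  (So l is the number of components and the i-th
-- component H_i is the fibre of label i.)
record ComponentLabelling {m : ℕ} (adj : Adjacency m) (l : ℕ) : Set where
  field
    label      : Fin m → Fin l
    surjective : ∀ (i : Fin l) → ∃ λ v → label v ≡ i
    sameComp   : ∀ u v → (label u ≡ label v → Reachable adj u v)
                       × (Reachable adj u v → label u ≡ label v)

component : {m l : ℕ} {adj : Adjacency m} → ComponentLabelling adj l → Fin l → Subset m
component {m} C i = Data.Vec.tabulate (λ v → does (ComponentLabelling.label C v ≟ i))
  where import Data.Vec

-- Lexicographic product G ∘ H on Fin (n * m); the vertex k corresponds to the
-- pair remQuot m k = (a , v) ∈ Fin n × Fin m.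
lexProduct : {n m : ℕ} → Adjacency n → Adjacency m → Adjacency (n Data.Nat.* m)
lexProduct {n} {m} adjG adjH k k' with remQuot {n} m k | remQuot {n} m k'
... | (a , v) | (b , w) = adjG a b ∨ (does (a ≟ b) ∧ adjH v w)

Forces : {n : ℕ} → Adjacency n → Subset n → Fin n → Fin n → Set
Forces adj S u v =
  u ∈ S × v ∉ S × adj u v ≡ true × (∀ w → adj u w ≡ true → w ≢ v → w ∈ S)

data EventuallyAllBlack {n : ℕ} (adj : Adjacency n) : Subset n → Set where
  done  : ∀ {S} → (∀ v → v ∈ S) → EventuallyAllBlack adj S
  force : ∀ {S} u v → Forces adj S u v → EventuallyAllBlack adj (S ∪ ⁅ v ⁆)
        → EventuallyAllBlack adj S

IsZeroForcingSet : {n : ℕ} → Adjacency n → Subset n → Set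
IsZeroForcingSet adj S = EventuallyAllBlack adj S

ZleQ : {n : ℕ} → Adjacency n → ℕ → Set
ZleQ {n} adj k = Σ (Subset n) λ S → IsZeroForcingSet adj S × ∣ S ∣ ≤ k

-- Pick one vertex a of G and, in every component H_i, an edge u_i v_i.
-- Colour everything black except the l vertices (a, v_i).  Inside the copy
-- {a} × H the vertex (a, u_i) is adjacent to (a, v_i) and to no other white
-- vertex (the other v_j lie in other components), and outside that copy there
-- are no white vertices at all; so (a, u_i) forces (a, v_i), for every i.
module Submission where

open import Defs
open import Data.Nat using (ℕ; zero; suc; _+_; _*_; _∸_; _≤_; _≥_)
import Data.Nat.Properties as ℕ
open import Data.Nat.ListAction using (sum)
open import Data.Bool using (true; false; if_then_else_; _∨_; _∧_)
open import Data.Fin using (Fin; combine; _≟_)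
import Data.Fin.Properties as Fin
open import Data.Fin.Subset using (Subset; _∈_; _∉_; _∪_; ⁅_⁆; ∣_∣; ⊤; _-_)
import Data.Fin.Subset.Properties as Subset
open import Data.List using (List; []; _∷_; map; allFin; length)
import Data.List.Properties as List
open import Data.List.Membership.Propositional using () renaming (_∈_ to _∈ₗ_; _∉_ to _∉ₗ_)
open import Data.List.Membership.Propositional.Properties using (∈-map⁻)
open import Data.List.Relation.Unary.Any using (here; there)
open import Data.List.Relation.Unary.All.Properties using (All¬⇒¬Any)
open import Data.List.Relation.Unary.AllPairs using ([]; _∷_)
open import Data.List.Relation.Unary.Unique.Propositional using (Unique)
open import Data.List.Relation.Unary.Unique.Propositional.Properties using (map⁺; allFin⁺)
import Data.Vec as Vec
import Data.Vec.Properties as Vec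
open import Data.Product using (_×_; _,_; ∃; ∃₂; proj₁; proj₂)
open import Data.Sum using (inj₁; inj₂)
open import Function using (_∘_; case_of_)
open import Relation.Nullary using (¬_; does; yes; no)
open import Relation.Nullary.Decidable using (_→-dec_; dec-true; decidable-stable)
open import Relation.Nullary.Negation using (contradiction)
open import Relation.Binary.PropositionalEquality

sum-map-+ : ∀ {A : Set} (f g : A → ℕ) xs →
            sum (map (λ x → f x + g x) xs) ≡ sum (map f xs) + sum (map g xs)
sum-map-+ f g []       = refl
sum-map-+ f g (x ∷ xs) = begin
  f x + g x + sum (map (λ x → f x + g x) xs)    ≡⟨ cong (f x + g x +_) (sum-map-+ f g xs) ⟩
  f x + g x + (sum (map f xs) + sum (map g xs))  ≡⟨ +-interchange (f x) (g x) _ _ ⟩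
  f x + sum (map f xs) + (g x + sum (map g xs))  ∎
  where
  open ≡-Reasoning
  open import Algebra.Properties.CommutativeSemigroup ℕ.+-commutativeSemigroup
    using () renaming (interchange to +-interchange)

sum-map-0 : ∀ {A : Set} (xs : List A) → sum (map (λ _ → 0) xs) ≡ 0
sum-map-0 []       = refl
sum-map-0 (_ ∷ xs) = sum-map-0 xs

sum-map-allFin-suc : ∀ {l} (f : Fin (suc l) → ℕ) →
                     sum (map f (allFin (suc l))) ≡ f Fin.zero + sum (map (f ∘ Fin.suc) (allFin l))
sum-map-allFin-suc f = cong (λ xs → f Fin.zero + sum xs)
  (trans (List.map-tabulate Fin.suc f) (sym (List.map-tabulate (λ i → i) (f ∘ Fin.suc))))

sum-map-allFin-≟ : ∀ {l} (x : Fin l) →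
                   sum (map (λ i → if does (x ≟ i) then 1 else 0) (allFin l)) ≡ 1
sum-map-allFin-≟ {suc l} Fin.zero    = begin
  sum (map (λ i → if does (Fin.zero ≟ i) then 1 else 0) (allFin (suc l)))
    ≡⟨ sum-map-allFin-suc {l} (λ i → if does (Fin.zero ≟ i) then 1 else 0) ⟩
  1 + sum (map (λ _ → 0) (allFin l))
    ≡⟨ cong suc (sum-map-0 (allFin l)) ⟩
  1 ∎
  where open ≡-Reasoning
sum-map-allFin-≟ {suc l} (Fin.suc x) =
  trans (sum-map-allFin-suc {l} (λ i → if does (Fin.suc x ≟ i) then 1 else 0)) (sum-map-allFin-≟ x)

fibre : ∀ {m l} → (Fin m → Fin l) → Fin l → Subset m
fibre f i = Vec.tabulate (λ v → does (f v ≟ i))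

∣x∷p∣≡ : ∀ {m} b (p : Subset m) → ∣ b Vec.∷ p ∣ ≡ (if b then 1 else 0) + ∣ p ∣
∣x∷p∣≡ true  p = refl
∣x∷p∣≡ false p = refl

sum-∣fibre∣≡ : ∀ {m l} (f : Fin m → Fin l) → sum (map (λ i → ∣ fibre f i ∣) (allFin l)) ≡ m
sum-∣fibre∣≡ {zero}  {l} f = sum-map-0 (allFin l)
sum-∣fibre∣≡ {suc m} {l} f = begin
  sum (map (λ i → ∣ fibre f i ∣) (allFin l))
    ≡⟨ cong sum (List.map-cong (λ i → ∣x∷p∣≡ (does (f Fin.zero ≟ i)) (fibre (f ∘ Fin.suc) i)) (allFin l)) ⟩
  sum (map (λ i → head i + ∣ fibre (f ∘ Fin.suc) i ∣) (allFin l))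
    ≡⟨ sum-map-+ head (λ i → ∣ fibre (f ∘ Fin.suc) i ∣) (allFin l) ⟩
  sum (map head (allFin l)) + sum (map (λ i → ∣ fibre (f ∘ Fin.suc) i ∣) (allFin l))
    ≡⟨ cong₂ _+_ (sum-map-allFin-≟ (f Fin.zero)) (sum-∣fibre∣≡ (f ∘ Fin.suc)) ⟩
  suc m ∎
  where
  open ≡-Reasoning
  head : Fin l → ℕ
  head i = if does (f Fin.zero ≟ i) then 1 else 0

allBut : ∀ {N} → List (Fin N) → Subset N
allBut []       = ⊤
allBut (x ∷ xs) = allBut xs - x

∉allBut⇒∈ : ∀ {N} (xs : List (Fin N)) {x} → x ∉ allBut xs → x ∈ₗ xs
∉allBut⇒∈ []       x∉ = contradiction Subset.∈⊤ x∉
∉allBut⇒∈ (y ∷ xs) {x} x∉ with x Fin.≟ y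
... | yes x≡y = here x≡y
... | no  x≢y = there (∉allBut⇒∈ xs (λ x∈ → x∉ (Subset.x∈p∧x≢y⇒x∈p-y x∈ x≢y)))

∉⇒∈allBut : ∀ {N} (xs : List (Fin N)) {x} → x ∉ₗ xs → x ∈ allBut xs
∉⇒∈allBut []       x∉ = Subset.∈⊤
∉⇒∈allBut (y ∷ xs) x∉ =
  Subset.x∈p∧x≢y⇒x∈p-y (∉⇒∈allBut xs (x∉ ∘ there)) (x∉ ∘ here)

∣allBut∣+length≤ : ∀ {N} {xs : List (Fin N)} → Unique xs → ∣ allBut xs ∣ + length xs ≤ N
∣allBut∣+length≤ {N} {[]} [] = ℕ.≤-reflexive (trans (ℕ.+-identityʳ _) (Subset.∣⊤∣≡n N))
∣allBut∣+length≤ {N} {x ∷ xs} (x∉xs ∷ unique) = begin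
  ∣ allBut xs - x ∣ + suc (length xs)  ≡⟨ ℕ.+-suc _ _ ⟩
  suc ∣ allBut xs - x ∣ + length xs    ≤⟨ ℕ.+-monoˡ-≤ (length xs) (Subset.x∈p⇒∣p-x∣<∣p∣ x∈allBut) ⟩
  ∣ allBut xs ∣ + length xs            ≤⟨ ∣allBut∣+length≤ unique ⟩
  N                                    ∎
  where
  open ℕ.≤-Reasoning
  x∈allBut : x ∈ allBut xs
  x∈allBut = ∉⇒∈allBut xs (All¬⇒¬Any x∉xs)

-- forcer i is adjacent to white i and to no other white j, so once every vertex
-- but the whites is black each forcer i can force white i: Z ≤ N ∸ k.
record PrivateForcing {N : ℕ} (adj : Adjacency N) (k : ℕ) : Set where
  field
    white forcer   : Fin k → Fin N
    forcer-adj     : ∀ i → adj (forcer i) (white i) ≡ true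
    forcer-private : ∀ i j → adj (forcer i) (white j) ≡ true → i ≡ j
    forcer≢white   : ∀ i j → forcer i ≢ white j

  white-injective : ∀ {i j} → white i ≡ white j → i ≡ j
  white-injective {i} {j} wi≡wj =
    forcer-private i j (subst (λ y → adj (forcer i) y ≡ true) wi≡wj (forcer-adj i))

  WhitesAmong : Subset N → List (Fin k) → Set
  WhitesAmong S is = ∀ {x} → x ∉ S → x ∈ₗ map white is

  WhitesAmong-∪ : ∀ {S T is} → WhitesAmong S is → WhitesAmong (S ∪ T) is
  WhitesAmong-∪ whitesIn x∉S∪T = whitesIn (x∉S∪T ∘ Subset.x∈p∪q⁺ ∘ inj₁)

  WhitesAmong-drop : ∀ {S i is} → white i ∈ S → WhitesAmong S (i ∷ is) → WhitesAmong S is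
  WhitesAmong-drop wi∈S whitesIn x∉S with whitesIn x∉S
  ... | here  refl = contradiction wi∈S x∉S
  ... | there x∈   = x∈

  ¬∉⇒∈ : ∀ {S x} → ¬ x ∉ S → x ∈ S
  ¬∉⇒∈ {S} {x} = decidable-stable (x Subset.∈? S)

  forces : ∀ {S is} i → WhitesAmong S is → white i ∉ S → Forces adj S (forcer i) (white i)
  forces {S} i whitesIn wi∉S =
    forcerBlack , wi∉S , forcer-adj i , othersBlack
    where
    isWhite : ∀ {x} → x ∉ S → ∃ λ j → x ≡ white j
    isWhite x∉S = let j , _ , x≡wj = ∈-map⁻ white (whitesIn x∉S) in j , x≡wj
    forcerBlack : forcer i ∈ S
    forcerBlack = ¬∉⇒∈ λ fi∉S → let j , fi≡wj = isWhite fi∉S in forcer≢white i j fi≡wj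
    othersBlack : ∀ x → adj (forcer i) x ≡ true → x ≢ white i → x ∈ S
    othersBlack x fi~x x≢wi = ¬∉⇒∈ λ x∉S → let j , x≡wj = isWhite x∉S in
      x≢wi (trans x≡wj (cong white (sym (forcer-private i j (subst (λ y → adj (forcer i) y ≡ true) x≡wj fi~x)))))

  eventuallyAllBlack : ∀ (is : List (Fin k)) {S} → WhitesAmong S is → EventuallyAllBlack adj S
  eventuallyAllBlack []       whitesIn = done λ x → ¬∉⇒∈ λ x∉S → case whitesIn x∉S of λ ()
  eventuallyAllBlack (i ∷ is) {S} whitesIn with white i Subset.∈? S
  ... | yes wi∈S = eventuallyAllBlack is (WhitesAmong-drop wi∈S whitesIn)
  ... | no  wi∉S = force (forcer i) (white i) (forces i whitesIn wi∉S)
    (eventuallyAllBlack is (WhitesAmong-drop (Subset.x∈p∪q⁺ (inj₂ (Subset.x∈⁅x⁆ (white i))))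
                                              (WhitesAmong-∪ whitesIn)))

  zeroForcing : ZleQ adj (N ∸ k)
  zeroForcing = allBut whites , eventuallyAllBlack (allFin k) (∉allBut⇒∈ whites) ,
    ℕ.m+n≤o⇒m≤o∸n ∣ allBut whites ∣ (subst (λ n → ∣ allBut whites ∣ + n ≤ N) length-whites
      (∣allBut∣+length≤ (map⁺ white-injective (allFin⁺ k))))
    where
    whites : List (Fin N)
    whites = map white (allFin k)
    length-whites : length whites ≡ k
    length-whites = trans (List.length-map white (allFin k)) (List.length-tabulate (λ i → i))

Reachable-≢⇒∃neighbour : ∀ {m} {adj : Adjacency m} {u v} → Reachable adj u v → u ≢ v →
                         ∃ λ w → adj u w ≡ true
Reachable-≢⇒∃neighbour here           u≢u = contradiction refl u≢u
Reachable-≢⇒∃neighbour (edge u~w _)   _   = _ , u~w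

∣p∣≥2⇒∃≢ : ∀ {m} (p : Subset m) (r : Fin m) → ∣ p ∣ ≥ 2 → ∃ λ x → x ∈ p × x ≢ r
∣p∣≥2⇒∃≢ {m} p r ∣p∣≥2 with Fin.¬∀⟶∃¬ m (λ x → x ∈ p → x ≡ r) (λ x → x Subset.∈? p →-dec x ≟ r) p⊈⁅r⁆
  where
  p⊈⁅r⁆ : ¬ (∀ x → x ∈ p → x ≡ r)
  p⊈⁅r⁆ p⊆⁅r⁆ = ℕ.<⇒≱ ∣p∣≥2 (subst (∣ p ∣ ≤_) (Subset.∣⁅x⁆∣≡1 r)
    (Subset.p⊆q⇒∣p∣≤∣q∣ λ {x} x∈p → subst (_∈ ⁅ r ⁆) (sym (p⊆⁅r⁆ x x∈p)) (Subset.x∈⁅x⁆ r)))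
... | x , ¬[x∈p→x≡r] with x Subset.∈? p
...   | yes x∈p = x , x∈p , λ x≡r → ¬[x∈p→x≡r] (λ _ → x≡r)
...   | no  x∉p = contradiction (λ x∈p → contradiction x∈p x∉p) ¬[x∈p→x≡r]

module _ {m l : ℕ} {H : Adjacency m} (C : ComponentLabelling H l) where
  open ComponentLabelling C

  ∈component⇒label≡ : ∀ {x i} → x ∈ component C i → label x ≡ i
  ∈component⇒label≡ {x} {i} x∈
    with label x ≟ i | trans (sym (Vec.lookup∘tabulate (λ v → does (label v ≟ i)) x)) (Vec.[]=⇒lookup x∈)
  ... | yes label≡i | _  = label≡i
  ... | no  _       | ()

  adjacent⇒label≡ : ∀ {u v} → H u v ≡ true → label u ≡ label v
  adjacent⇒label≡ {u} {v} u~v = proj₂ (sameComp u v) (edge u~v here)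

  edgeInComponent : ∀ i → ∣ component C i ∣ ≥ 2 → ∃₂ λ u v → label u ≡ i × H u v ≡ true
  edgeInComponent i big =
    let u , u∈i       = surjective i
        x , x∈i , x≢u = ∣p∣≥2⇒∃≢ (component C i) u big
        u⇝x           = proj₁ (sameComp u x) (trans u∈i (sym (∈component⇒label≡ x∈i)))
        v , u~v       = Reachable-≢⇒∃neighbour u⇝x (x≢u ∘ sym)
    in u , v , u∈i , u~v

  componentsPrivateForcing : (∀ v → H v v ≡ false) → (∀ i → ∣ component C i ∣ ≥ 2) →
                             PrivateForcing H l
  componentsPrivateForcing irrefl big = record
    { white          = white
    ; forcer         = forcer
    ; forcer-adj     = forcer-adj
    ; forcer-private = forcer-private
    ; forcer≢white   = forcer≢white
    }
    where
    forcer white : Fin l → Fin m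
    forcer i = proj₁ (edgeInComponent i (big i))
    white i = proj₁ (proj₂ (edgeInComponent i (big i)))

    label-forcer : ∀ i → label (forcer i) ≡ i
    label-forcer i = proj₁ (proj₂ (proj₂ (edgeInComponent i (big i))))

    forcer-adj : ∀ i → H (forcer i) (white i) ≡ true
    forcer-adj i = proj₂ (proj₂ (proj₂ (edgeInComponent i (big i))))

    label-white : ∀ i → label (white i) ≡ i
    label-white i = trans (sym (adjacent⇒label≡ (forcer-adj i))) (label-forcer i)

    forcer-private : ∀ i j → H (forcer i) (white j) ≡ true → i ≡ j
    forcer-private i j fi~wj =
      trans (sym (label-forcer i)) (trans (adjacent⇒label≡ fi~wj) (label-white j))

    forcer≢white : ∀ i j → forcer i ≢ white j
    forcer≢white i j fi≡wj with refl ← trans (sym (label-forcer i)) (trans (cong label fi≡wj) (label-white j))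
      = case trans (sym (irrefl (white i))) (subst (λ y → H y (white i) ≡ true) fi≡wj (forcer-adj i)) of λ ()

module _ {n m : ℕ} (G : Adjacency n) (H : Adjacency m) {a : Fin n} (Gaa≡false : G a a ≡ false) where

  lexProduct-row : ∀ v w → lexProduct G H (combine a v) (combine a w) ≡ H v w
  lexProduct-row v w = begin
    lexProduct G H (combine a v) (combine a w)
      ≡⟨ cong₂ (λ (b , v′) (c , w′) → G b c ∨ (does (b ≟ c) ∧ H v′ w′))
               (Fin.remQuot-combine a v) (Fin.remQuot-combine a w) ⟩
    G a a ∨ (does (a ≟ a) ∧ H v w)
      ≡⟨ cong₂ (λ g d → g ∨ (d ∧ H v w)) Gaa≡false (dec-true (a ≟ a) refl) ⟩
    H v w ∎
    where open ≡-Reasoning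

  lexProduct-privateForcing : ∀ {k} → PrivateForcing H k → PrivateForcing (lexProduct G H) k
  lexProduct-privateForcing P = record
    { white          = combine a ∘ white
    ; forcer         = combine a ∘ forcer
    ; forcer-adj     = λ i → trans (lexProduct-row (forcer i) (white i)) (forcer-adj i)
    ; forcer-private = λ i j fi~wj → forcer-private i j (trans (sym (lexProduct-row (forcer i) (white j))) fi~wj)
    ; forcer≢white   = λ i j fi≡wj → forcer≢white i j (Fin.combine-injectiveʳ a (forcer i) a (white j) fi≡wj)
    }
    where open PrivateForcing P

mainTheorem2 : (n m l : ℕ) (G : Adjacency n) (H : Adjacency m)
    → IsSimple G → IsSimple H → Connected G → n ≥ 2
    → (C : ComponentLabelling H l) → l ≥ 1
    → (∀ (i : Fin l) → ∣ component C i ∣ ≥ 2)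
    → ZleQ (lexProduct G H) (n * sum (map (λ i → ∣ component C i ∣) (allFin l)) ∸ l)
mainTheorem2 (suc n) m l G H simpleG simpleH _ _ C _ big =
  -- component C i is, by definition, fibre (label C) i
  subst (λ s → ZleQ (lexProduct G H) (suc n * s ∸ l))
        (sym (sum-∣fibre∣≡ (ComponentLabelling.label C)))
        (PrivateForcing.zeroForcing privateForcing)
  where
  privateForcing : PrivateForcing (lexProduct G H) l
  privateForcing = lexProduct-privateForcing G H (IsSimple.irreflexive simpleG Fin.zero)
    (componentsPrivateForcing C (IsSimple.irreflexive simpleH) big)
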